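{- Let $A$ and $B$ be two ordered graphs. Then for every $n\ge 0$, $g_{A\cdot B}(n)\ge\min\{g_A(\lfloor n/2\rfloor),g_B(\lceil n/2\rceil)\}$.
   Context: An ordered graph is a graph with a total order on its vertex set. The concatenation $A\cdot B$ is the ordered graph which is the disjoint union of $A$ and $B$, ordered by the vertices of $A$ in their order followed by the vertices of $B$ in their order. For a graph $G$ with a Hamiltonian path $P=v_1,\dots,v_n$, $(G,P)$ contains the ordered graph $H$ (order $u_1,\dots,u_k$) as a pattern if there exist $1\le a_1<\dots<a_k\le n$ such that every edge $u_iu_j$ of $H$ maps to an edge $v_{a_i}v_{a_j}$ of $G-E(P)$; otherwise $(G,P)$ avoids $H$. $g_H(n)$ is the maximum integer $t$ such that for every graph $G$ with a Hamiltonian path $P$ on $n$ vertices, if $(G,P)$ avoids $H$ then $G$ contains an induced path on at least $t$ vertices. -}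

module Defs where

open import Data.Nat using (ℕ; zero; suc; _+_; _≤_; _<_)
open import Data.Fin using (Fin; toℕ; splitAt)
import Data.Fin as F
open import Data.Bool using (Bool; true; false)
open import Data.Sum using (_⊎_; inj₁; inj₂)
open import Data.Product using (Σ; ∃; _×_; _,_)
open import Relation.Nullary using (¬_)
open import Relation.Binary.PropositionalEquality using (_≡_; refl)
open import Function.Definitions using (Bijective; Injective)

record Graph (n : ℕ) : Set where
  field
    adj    : Fin n → Fin n → Bool
    sym    : ∀ x y → adj x y ≡ adj y x
    irrefl : ∀ x → adj x x ≡ false
open Graph public

-- An ordered graph on k vertices: a graph on Fin k, ordered by the order of Fin k.
OrderedGraph : ℕ → Set
OrderedGraph k = Graph k

Consec : ∀ {m} → Fin m → Fin m → Set
Consec i j = (suc (toℕ i) ≡ toℕ j) ⊎ (suc (toℕ j) ≡ toℕ i)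

catAdj : ∀ {k l} → Graph k → Graph l → Fin (k + l) → Fin (k + l) → Bool
catAdj {k} A B x y with splitAt k x | splitAt k y
... | inj₁ i | inj₁ j = adj A i j
... | inj₂ i | inj₂ j = adj B i j
... | inj₁ _ | inj₂ _ = false
... | inj₂ _ | inj₁ _ = false

catSym : ∀ {k l} (A : Graph k) (B : Graph l) x y → catAdj A B x y ≡ catAdj A B y x
catSym {k} A B x y with splitAt k x | splitAt k y
... | inj₁ i | inj₁ j = sym A i j
... | inj₂ i | inj₂ j = sym B i j
... | inj₁ _ | inj₂ _ = refl
... | inj₂ _ | inj₁ _ = refl

catIrrefl : ∀ {k l} (A : Graph k) (B : Graph l) x → catAdj A B x x ≡ false
catIrrefl {k} A B x with splitAt k x
... | inj₁ i = irrefl A i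
... | inj₂ i = irrefl B i

_·_ : ∀ {k l} → OrderedGraph k → OrderedGraph l → OrderedGraph (k + l)
A · B = record { adj = catAdj A B ; sym = catSym A B ; irrefl = catIrrefl A B }

record HamPath {n : ℕ} (G : Graph n) : Set where
  field
    vtx     : Fin n → Fin n
    bij     : Bijective _≡_ _≡_ vtx
    consecE : ∀ i j → suc (toℕ i) ≡ toℕ j → adj G (vtx i) (vtx j) ≡ true
open HamPath public

PathEdge : ∀ {n} {G : Graph n} → HamPath G → Fin n → Fin n → Set
PathEdge P x y = Σ _ λ i → Σ _ λ j → Consec i j × vtx P i ≡ x × vtx P j ≡ y

EdgeMinusP : ∀ {n} (G : Graph n) → HamPath G → Fin n → Fin n → Set
EdgeMinusP G P x y = (adj G x y ≡ true) × ¬ PathEdge P x y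

Contains : ∀ {k n} → OrderedGraph k → (G : Graph n) → HamPath G → Set
Contains {k} {n} H G P =
  Σ (Fin k → Fin n) λ a →
    (∀ i j → i F.< j → a i F.< a j) ×
    (∀ i j → adj H i j ≡ true → EdgeMinusP G P (vtx P (a i)) (vtx P (a j)))

Avoids : ∀ {k n} → OrderedGraph k → (G : Graph n) → HamPath G → Set
Avoids H G P = ¬ Contains H G P

InducedPath : ∀ {n} → Graph n → ℕ → Set
InducedPath {n} G m =
  Σ (Fin m → Fin n) λ p →
    Injective _≡_ _≡_ p ×
    (∀ i j → adj G (p i) (p j) ≡ true → Consec i j) ×
    (∀ i j → Consec i j → adj G (p i) (p j) ≡ true)

GBound : ∀ {k} → OrderedGraph k → ℕ → ℕ → Set
GBound H n t = ∀ (G : Graph n) (P : HamPath G) → Avoids H G P →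
  Σ ℕ λ m → t ≤ m × InducedPath G m

-- g_H(n) = t : t is the maximum integer with the property
IsG : ∀ {k} → OrderedGraph k → ℕ → ℕ → Set
IsG H n t = GBound H n t × (∀ t′ → GBound H n t′ → t′ ≤ t)

-- Cut the Hamiltonian path P of G into its first ⌊n/2⌋ and last ⌈n/2⌉ vertices. Each half
-- induces a graph with a Hamiltonian path (the corresponding piece of P), whose induced paths
-- are induced paths of G and whose edges off the piece are edges of G off P. Patterns of A in
-- the first half and of B in the second therefore combine to a pattern of A · B in G, so if
-- (G, P) avoids A · B then the first half avoids A or the second avoids B. Containment of a
-- pattern is decidable, which makes this case split constructive.
module Submission where

open import Defs
open import Data.Nat using (ℕ; _≤_; _⊓_; ⌊_/2⌋; ⌈_/2⌉)
import Data.Nat as ℕ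
import Data.Nat.Properties as ℕ
open import Data.Fin as Fin using (Fin; toℕ; splitAt; _↑ˡ_; _↑ʳ_)
import Data.Fin.Properties as Fin
open import Data.Vec.Functional using (_∷_; head; tail)
open import Data.Bool using (true)
import Data.Bool.Properties as Bool
open import Data.Sum using (_⊎_; inj₁; inj₂)
open import Data.Product using (∃; _×_; _,_; proj₁; map; map₂)
open import Function using (case_of_)
open import Relation.Nullary using (Dec; yes; no; contradiction)
open import Relation.Nullary.Decidable using (map′; _×-dec_; _⊎-dec_; _→-dec_; ¬?)
open import Relation.Binary.PropositionalEquality
  using (_≡_; refl; cong; subst; subst₂; module ≡-Reasoning)
  renaming (sym to ≡-sym; trans to ≡-trans)

any-function? : ∀ k n {P : (Fin k → Fin n) → Set} →
  (∀ {f g} → (∀ i → f i ≡ g i) → P f → P g) →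
  (∀ f → Dec (P f)) → Dec (∃ P)
any-function? ℕ.zero n resp P? =
  map′ (λ p → _ , p) (λ { (f , p) → resp (λ ()) p }) (P? λ ())
any-function? (ℕ.suc k) n {P} resp P? =
  map′ (λ { (x , f , p) → x ∷ f , p })
       (λ { (f , p) → head f , tail f , resp (λ { Fin.zero → refl ; (Fin.suc i) → refl }) p })
       (Fin.any? λ x → any-function? k n
          (λ f≗g → resp λ { Fin.zero → refl ; (Fin.suc i) → f≗g i })
          (λ f → P? (x ∷ f)))

Consec? : ∀ {m} (i j : Fin m) → Dec (Consec i j)
Consec? i j = (ℕ.suc (toℕ i) ℕ.≟ toℕ j) ⊎-dec (ℕ.suc (toℕ j) ℕ.≟ toℕ i)

PathEdge? : ∀ {n} {G : Graph n} (P : HamPath G) x y → Dec (PathEdge P x y)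
PathEdge? P x y = Fin.any? λ i → Fin.any? λ j →
  Consec? i j ×-dec (vtx P i Fin.≟ x) ×-dec (vtx P j Fin.≟ y)

Contains? : ∀ {k n} (H : OrderedGraph k) (G : Graph n) (P : HamPath G) → Dec (Contains H G P)
Contains? {k} {n} H G P = any-function? k n {Embeds} resp embeds?
  where
  Embeds : (Fin k → Fin n) → Set
  Embeds a = (∀ i j → i Fin.< j → a i Fin.< a j) ×
             (∀ i j → adj H i j ≡ true → EdgeMinusP G P (vtx P (a i)) (vtx P (a j)))
  resp : ∀ {f g} → (∀ i → f i ≡ g i) → Embeds f → Embeds g
  resp f≗g (mono , edges) =
    (λ i j i<j → subst₂ Fin._<_ (f≗g i) (f≗g j) (mono i j i<j)) ,
    (λ i j e → subst₂ (λ a b → EdgeMinusP G P (vtx P a) (vtx P b)) (f≗g i) (f≗g j) (edges i j e))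
  embeds? : ∀ f → Dec (Embeds f)
  embeds? f =
    (Fin.all? λ i → Fin.all? λ j → (i Fin.<? j) →-dec (f i Fin.<? f j)) ×-dec
    (Fin.all? λ i → Fin.all? λ j → (adj H i j Bool.≟ true) →-dec
      ((adj G (vtx P (f i)) (vtx P (f j)) Bool.≟ true) ×-dec ¬? (PathEdge? P _ _)))

-- The segment is the path positions c, …, c + m − 1, given as Fin n by e. Its graph is
-- re-indexed by path position, so that its Hamiltonian path is the identity.
module Segment {n m} (G : Graph n) (P : HamPath G) (c : ℕ) (e : Fin m → Fin n)
                (toℕ-e : ∀ i → toℕ (e i) ≡ c ℕ.+ toℕ i) where

  graph : Graph m
  graph = record
    { adj    = λ i j → adj G (vtx P (e i)) (vtx P (e j))
    ; sym    = λ i j → Graph.sym G _ _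
    ; irrefl = λ i → irrefl G _
    }

  suc-shift : ∀ {i j} → ℕ.suc (toℕ i) ≡ toℕ j → ℕ.suc (toℕ (e i)) ≡ toℕ (e j)
  suc-shift {i} {j} i+1≡j = begin
    ℕ.suc (toℕ (e i))   ≡⟨ cong ℕ.suc (toℕ-e i) ⟩
    ℕ.suc (c ℕ.+ toℕ i) ≡⟨ ℕ.+-suc c (toℕ i) ⟨
    c ℕ.+ ℕ.suc (toℕ i) ≡⟨ cong (c ℕ.+_) i+1≡j ⟩
    c ℕ.+ toℕ j         ≡⟨ toℕ-e j ⟨
    toℕ (e j)           ∎
    where open ≡-Reasoning

  suc-unshift : ∀ {i j} → ℕ.suc (toℕ (e i)) ≡ toℕ (e j) → ℕ.suc (toℕ i) ≡ toℕ j
  suc-unshift {i} {j} ei+1≡ej = ℕ.+-cancelˡ-≡ c _ _ (begin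
    c ℕ.+ ℕ.suc (toℕ i) ≡⟨ ℕ.+-suc c (toℕ i) ⟩
    ℕ.suc (c ℕ.+ toℕ i) ≡⟨ cong ℕ.suc (toℕ-e i) ⟨
    ℕ.suc (toℕ (e i))   ≡⟨ ei+1≡ej ⟩
    toℕ (e j)           ≡⟨ toℕ-e j ⟩
    c ℕ.+ toℕ j         ∎)
    where open ≡-Reasoning

  e-injective : ∀ {i j} → e i ≡ e j → i ≡ j
  e-injective {i} {j} ei≡ej = Fin.toℕ-injective (ℕ.+-cancelˡ-≡ c _ _
    (≡-trans (≡-sym (toℕ-e i)) (≡-trans (cong toℕ ei≡ej) (toℕ-e j))))

  path : HamPath graph
  path = record
    { vtx     = λ i → i
    ; bij     = (λ i≡j → i≡j) , (λ i → i , λ i≡j → i≡j)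
    ; consecE = λ i j i+1≡j → consecE P (e i) (e j) (suc-shift i+1≡j)
    }

  Consec-unshift : ∀ {i j} → Consec (e i) (e j) → Consec i j
  Consec-unshift (inj₁ ei+1≡ej) = inj₁ (suc-unshift ei+1≡ej)
  Consec-unshift (inj₂ ej+1≡ei) = inj₂ (suc-unshift ej+1≡ei)

  v-injective : ∀ {a b} → vtx P a ≡ vtx P b → a ≡ b
  v-injective = proj₁ (bij P)

  EdgeMinusP-lift : ∀ i j → EdgeMinusP graph path i j → EdgeMinusP G P (vtx P (e i)) (vtx P (e j))
  EdgeMinusP-lift i j (edge , notInPath) = edge , λ where
    (i′ , j′ , consec , vi′≡vei , vj′≡vej) → notInPath
      (i , j , Consec-unshift (subst₂ Consec (v-injective vi′≡vei) (v-injective vj′≡vej) consec) ,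
       refl , refl)

  InducedPath-lift : ∀ {t} → InducedPath graph t → InducedPath G t
  InducedPath-lift (p , p-injective , edge⇒consec , consec⇒edge) =
    (λ i → vtx P (e (p i))) ,
    (λ same → p-injective (e-injective (v-injective same))) ,
    edge⇒consec , consec⇒edge

module Halves {h h′} (G : Graph (h ℕ.+ h′)) (P : HamPath G) where

  module Left  = Segment G P 0 (_↑ˡ h′) (λ i → Fin.toℕ-↑ˡ i h′)
  module Right = Segment G P h (h ↑ʳ_) (Fin.toℕ-↑ʳ h)

  Contains-· : ∀ {k l} {A : OrderedGraph k} {B : OrderedGraph l} →
    Contains A Left.graph Left.path → Contains B Right.graph Right.path → Contains (A · B) G P
  Contains-· {k} {l} {A} {B} (a₁ , mono₁ , edges₁) (a₂ , mono₂ , edges₂) = a , mono , edges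
    where
    place : Fin k ⊎ Fin l → Fin (h ℕ.+ h′)
    place (inj₁ i) = a₁ i ↑ˡ h′
    place (inj₂ j) = h ↑ʳ a₂ j

    a : Fin (k ℕ.+ l) → Fin (h ℕ.+ h′)
    a x = place (splitAt k x)

    toℕ-inj₁ : ∀ {x i} → splitAt k x ≡ inj₁ i → toℕ x ≡ toℕ i
    toℕ-inj₁ {x} {i} split = ≡-trans (cong toℕ (≡-sym (Fin.splitAt⁻¹-↑ˡ split))) (Fin.toℕ-↑ˡ i l)

    toℕ-inj₂ : ∀ {x j} → splitAt k x ≡ inj₂ j → toℕ x ≡ k ℕ.+ toℕ j
    toℕ-inj₂ {x} {j} split = ≡-trans (cong toℕ (≡-sym (Fin.splitAt⁻¹-↑ʳ split))) (Fin.toℕ-↑ʳ k j)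

    mono : ∀ x y → x Fin.< y → a x Fin.< a y
    mono x y x<y with splitAt k x in splitx | splitAt k y in splity
    ... | inj₁ i | inj₁ j =
      subst₂ ℕ._<_ (≡-sym (Fin.toℕ-↑ˡ (a₁ i) h′)) (≡-sym (Fin.toℕ-↑ˡ (a₁ j) h′))
        (mono₁ i j (subst₂ ℕ._<_ (toℕ-inj₁ splitx) (toℕ-inj₁ splity) x<y))
    ... | inj₂ i | inj₂ j =
      subst₂ ℕ._<_ (≡-sym (Fin.toℕ-↑ʳ h (a₂ i))) (≡-sym (Fin.toℕ-↑ʳ h (a₂ j)))
        (ℕ.+-monoʳ-< h (mono₂ i j
          (ℕ.+-cancelˡ-< k _ _ (subst₂ ℕ._<_ (toℕ-inj₂ splitx) (toℕ-inj₂ splity) x<y))))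
    ... | inj₁ i | inj₂ j =
      subst₂ ℕ._<_ (≡-sym (Fin.toℕ-↑ˡ (a₁ i) h′)) (≡-sym (Fin.toℕ-↑ʳ h (a₂ j)))
        (ℕ.<-≤-trans (Fin.toℕ<n (a₁ i)) (ℕ.m≤m+n h _))
    ... | inj₂ i | inj₁ j = contradiction x<y (ℕ.<⇒≯ (begin-strict
      toℕ y       ≡⟨ toℕ-inj₁ splity ⟩
      toℕ j       <⟨ Fin.toℕ<n j ⟩
      k           ≤⟨ ℕ.m≤m+n k (toℕ i) ⟩
      k ℕ.+ toℕ i ≡⟨ toℕ-inj₂ splitx ⟨
      toℕ x       ∎))
      where open ℕ.≤-Reasoning

    edges : ∀ x y → adj (A · B) x y ≡ true → EdgeMinusP G P (vtx P (a x)) (vtx P (a y))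
    edges x y edge with splitAt k x | splitAt k y
    ... | inj₁ i | inj₁ j = Left.EdgeMinusP-lift (a₁ i) (a₁ j) (edges₁ i j edge)
    ... | inj₂ i | inj₂ j = Right.EdgeMinusP-lift (a₂ i) (a₂ j) (edges₂ i j edge)
    ... | inj₁ _ | inj₂ _ = contradiction edge λ ()
    ... | inj₂ _ | inj₁ _ = contradiction edge λ ()

GBound-· : ∀ {k l} {A : OrderedGraph k} {B : OrderedGraph l} {h h′ gA gB} →
  GBound A h gA → GBound B h′ gB → GBound (A · B) (h ℕ.+ h′) (gA ⊓ gB)
GBound-· {A = A} {B} {h} {h′} {gA} {gB} boundA boundB G P avoids =
  case Contains? A Left.graph Left.path of λ where
    (no avoidsLeft) →
      map₂ (map (ℕ.≤-trans (ℕ.m⊓n≤m gA gB)) Left.InducedPath-lift)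
        (boundA Left.graph Left.path avoidsLeft)
    (yes containsLeft) →
      map₂ (map (ℕ.≤-trans (ℕ.m⊓n≤n gA gB)) Right.InducedPath-lift)
        (boundB Right.graph Right.path λ containsRight → avoids (Contains-· containsLeft containsRight))
  where open Halves {h} {h′} G P

lemma9 : ∀ {k l} (A : OrderedGraph k) (B : OrderedGraph l) (n gA gB gAB : ℕ) →
    IsG A ⌊ n /2⌋ gA → IsG B ⌈ n /2⌉ gB → IsG (A · B) n gAB →
    gA ⊓ gB ≤ gAB
lemma9 A B n gA gB gAB (boundA , _) (boundB , _) (_ , maximal) =
  maximal (gA ⊓ gB)
    (subst (λ n → GBound (A · B) n (gA ⊓ gB)) (ℕ.⌊n/2⌋+⌈n/2⌉≡n n) (GBound-· boundA boundB))
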